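{- Let $(W,S)$ be a finite Coxeter system and let $B(W)$ be its Bruhat graph. Then the discrete Ricci curvature of $B(W)$ equals $2$, i.e. $\mathrm{Ric}(B(W))=2$.
   Context: A Coxeter system $(W,S)$ consists of a group $W$ with finite generating set $S=\{s_i\}_{i\in I}$ and presentation $(s_is_j)^{m_{ij}}=e$, where $m_{ii}=1$ and $m_{ij}=m_{ji}\ge 2$ for $i\ne j$. The length $\ell(w)$ is the minimal length of an expression of $w$ as a product of elements of $S$. The set of reflections is $T=\bigcup_{w\in W} wSw^{ -1}$. The Bruhat graph $B(W)$ is the simple undirected graph with vertex set $W$, where $w,v$ are joined by an edge iff $v=tw$ for some $t\in T$ with $\ell(v)<\ell(w)$, or $w=tv$ for some $t\in T$ with $\ell(w)<\ell(v)$. For a locally finite simple graph $G$ without isolated vertices, with graph distance $\delta$, let $B(1,x)$ be the set of neighbours of $x$. For real functions $f,g$ on the vertex set and a vertex $x$ define $\Delta(f)(x)=\sum_{v\in B(1,x)}(f(v)-f(x))$, $\Gamma(f,g)(x)=\frac12\sum_{v\in B(1,x)}(f(x)-f(v))(g(x)-g(v))$, $\Gamma(f)=\Gamma(f,f)$, and $\Gamma_2(f)(x)=\frac12\Delta(\Gamma(f,f))(x)-\Gamma(f,\Delta f)(x)$. The discrete Ricci curvature $\mathrm{Ric}(G)$ is the maximal $K\in\mathbb{R}\cup\{ -\infty\}$ such that $\Gamma_2(f)(x)\ge K\,\Gamma(f)(x)$ for every real function $f$ on the vertices and every vertex $x$.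
   Formalization: In the discrete Ricci curvature, the functions f take values in ℚ rather than in the reals, and the constants K compared with 2 are rational. -}

module Defs where

open import Level using (0ℓ)
open import Data.Nat as ℕ using (ℕ; zero; suc)
open import Data.Fin using (Fin)
open import Data.List using (List; []; _∷_; foldr; length)
open import Data.List.Membership.Propositional using (_∈_)
open import Data.List.Relation.Unary.Unique.Propositional using (Unique)
open import Data.Integer using (+_)
open import Data.Rational as ℚ using (ℚ; 0ℚ; ½; _+_; _*_; _-_; _≤_; _<_)
open import Data.Product using (Σ; ∃; ∃-syntax; _×_; _,_)
open import Data.Sum using (_⊎_)
open import Relation.Binary.PropositionalEquality using (_≡_; _≢_)
open import Function.Bundles using (_⇔_)
open import Algebra.Bundles using (Group)

gpow : (G : Group 0ℓ 0ℓ) → Group.Carrier G → ℕ → Group.Carrier G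
gpow G x zero    = Group.ε G
gpow G x (suc k) = Group._∙_ G x (gpow G x k)

powW : {W : Set} → (W → W → W) → W → W → ℕ → W
powW _·_ e x zero    = e
powW _·_ e x (suc k) = x · powW _·_ e x k

prodW : {W : Set} {n : ℕ} → (W → W → W) → W → (Fin n → W) → List (Fin n) → W
prodW _·_ e s = foldr (λ i w → s i · w) e

-- A Coxeter system (W,S), S = {s_i}_{i ∈ Fin n}: W is a group (with
-- propositional equality) generated by the s_i, satisfying the Coxeter
-- relations (s_i s_j)^{m_ij} = e, and universal with respect to them
-- (i.e. W is presented by these generators and relations).
record CoxeterSystem : Set₁ where
  field
    W   : Set
    _·_ : W → W → W
    e   : W
    inv : W → W
    assoc     : ∀ x y z → (x · y) · z ≡ x · (y · z)
    identityˡ : ∀ x → e · x ≡ x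
    identityʳ : ∀ x → x · e ≡ x
    inverseˡ  : ∀ x → inv x · x ≡ e
    inverseʳ  : ∀ x → x · inv x ≡ e
    n : ℕ
    s : Fin n → W
    m : Fin n → Fin n → ℕ
    m-diag : ∀ i → m i i ≡ 1
    m-sym  : ∀ i j → m i j ≡ m j i
    m-off  : ∀ i j → i ≢ j → 2 ℕ.≤ m i j

  field
    relations : ∀ i j → powW _·_ e (s i · s j) (m i j) ≡ e
    generated : ∀ w → ∃[ word ] prodW _·_ e s word ≡ w
    universal : (G : Group 0ℓ 0ℓ) (g : Fin n → Group.Carrier G) →
      (∀ i j → Group._≈_ G (gpow G (Group._∙_ G (g i) (g j)) (m i j)) (Group.ε G)) →
      Σ (W → Group.Carrier G) λ φ →
        (∀ x y → Group._≈_ G (φ (x · y)) (Group._∙_ G (φ x) (φ y))) ×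
        (∀ i → Group._≈_ G (φ (s i)) (g i))

module _ (C : CoxeterSystem) where
  open CoxeterSystem C

  prod : List (Fin n) → W
  prod = prodW _·_ e s

  FiniteW : Set
  FiniteW = ∃[ xs ] (∀ (w : W) → w ∈ xs)

  IsLength : W → ℕ → Set
  IsLength w k = (∃[ word ] (length word ≡ k × prod word ≡ w))
               × (∀ word → prod word ≡ w → k ℕ.≤ length word)

  IsReflection : W → Set
  IsReflection t = ∃[ w ] ∃[ i ] t ≡ (w · s i) · inv w

  BelowBy : W → W → Set
  BelowBy v w = ∃[ t ] (IsReflection t × v ≡ t · w ×
                 ∃[ a ] ∃[ b ] (IsLength v a × IsLength w b × a ℕ.< b))

  Adj : W → W → Set
  Adj w v = BelowBy v w ⊎ BelowBy w v

  NoIsolated : Set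
  NoIsolated = ∀ x → ∃[ v ] Adj x v

  IsNeighbourhood : (W → List W) → Set
  IsNeighbourhood N = ∀ x → Unique (N x) × (∀ v → (v ∈ N x) ⇔ Adj x v)

sumℚ : List ℚ → ℚ
sumℚ = foldr _+_ 0ℚ

module Operators {V : Set} (N : V → List V) where

  sumOver : V → (V → ℚ) → ℚ
  sumOver x h = sumℚ (Data.List.map h (N x))

  Δ : (V → ℚ) → V → ℚ
  Δ f x = sumOver x (λ v → f v - f x)

  Γ : (V → ℚ) → (V → ℚ) → V → ℚ
  Γ f g x = ½ * sumOver x (λ v → (f x - f v) * (g x - g v))

  Γ₂ : (V → ℚ) → V → ℚ
  Γ₂ f x = ½ * Δ (Γ f f) x - Γ f (Δ f) x

  RicEq : ℚ → Set
  RicEq K = (∀ (f : V → ℚ) x → K * Γ f f x ≤ Γ₂ f x)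
          × (∀ K' → K < K' → ∃[ f ] ∃[ x ] (Γ₂ f x < K' * Γ f f x))

2ℚ : ℚ
2ℚ = + 2 ℚ./ 1

-- The Bruhat graph is the Cayley graph of W with respect to the set T of reflections: v and w
-- are adjacent iff v w⁻¹ ∈ T, because a reflection flips the sign (-1)^ℓ and so never preserves
-- length. T is a conjugation-invariant set of involutions, and for such Cayley graphs Bochner's
-- formula reads Γ₂ f x = ¼ Σ_{t,u ∈ T} (f(utx) - f(tx) - f(ux) + f(x))², the cross terms
-- cancelling by conjugation invariance; the diagonal terms u = t alone give 2 Γ(f)(x), so Ric ≥ 2.
-- The graph is also regular and bipartite; taking for f the distance to e on the ball of radius
-- two gives Γ₂ f e ≤ 2 Γ(f)(e) with Γ(f)(e) > 0, so Ric ≤ 2.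
module Submission where

open import Level using (0ℓ)
open import Algebra.Bundles using (Group; AbelianGroup; CommutativeRing)
open import Algebra.Structures using (IsGroup)
open import Data.Bool using (Bool; true; false; not; _xor_)
open import Data.Bool.Properties using (xor-∧-commutativeRing; xor-same; xor-identityʳ; not-¬; not-involutive)
import Data.Bool as Bool
open import Data.Empty using (⊥-elim)
open import Data.List using (List; []; _∷_; map; length)
open import Data.List.Properties using (map-∘)
open import Data.List.Membership.Propositional using (_∈_)
open import Data.List.Membership.Propositional.Properties using (∈-map⁺; ∈-map⁻)
open import Data.List.Membership.Propositional.Properties.WithK using (unique∧set⇒bag)
open import Data.List.Relation.Binary.BagAndSetEquality using (∼bag⇒↭)
open import Data.List.Relation.Binary.Permutation.Propositional using (_↭_; ↭⇒↭ₛ)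
import Data.List.Relation.Binary.Permutation.Propositional.Properties as ↭
open import Data.List.Relation.Binary.Permutation.Setoid.Properties using (foldr-commMonoid)
import Data.List.Relation.Unary.All as All
open import Data.List.Relation.Unary.Any using (here; there)
open import Data.List.Relation.Unary.Unique.Propositional using (Unique; []; _∷_)
import Data.List.Relation.Unary.Unique.Propositional.Properties as Unique
open import Data.Nat as ℕ using (ℕ; zero; suc)
open import Data.Nat.Properties using (n≮0)
open import Data.Product using (∃; _×_; _,_; proj₁; proj₂)
open import Data.Rational using (ℚ; 0ℚ; 1ℚ; ½; _+_; _*_; _-_; -_; _≤_; _<_)
open import Data.Rational.Properties as ℚ using ()
open import Data.Rational.Solver using (module +-*-Solver)
open import Data.Sum using (_⊎_; inj₁; inj₂)
open import Function using (_∘_)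
open import Function.Bundles using (_⇔_; mk⇔; Equivalence)
open import Relation.Binary.Definitions using (tri<; tri≈; tri>)
open import Relation.Binary.PropositionalEquality
  using (_≡_; _≢_; refl; sym; trans; cong; cong₂; subst; subst₂; module ≡-Reasoning)
import Relation.Binary.PropositionalEquality as ≡
open import Relation.Nullary using (Dec; yes; no)

open import Defs

open +-*-Solver

Σ : {A : Set} → List A → (A → ℚ) → ℚ
Σ xs g = sumℚ (map g xs)

ΣΣ : {A : Set} → List A → (A → A → ℚ) → ℚ
ΣΣ xs g = Σ xs (λ a → Σ xs (g a))

sq : ℚ → ℚ
sq a = a * a

sq-nonneg : ∀ p → 0ℚ ≤ sq p
sq-nonneg p with ℚ.≤-total 0ℚ p
... | inj₁ 0≤p = let instance _ = Data.Rational.nonNegative 0≤p in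
  ℚ.nonNegative⁻¹ (p * p) {{ℚ.nonNeg*nonNeg⇒nonNeg p p}}
... | inj₂ p≤0 = let instance _ = Data.Rational.nonPositive p≤0 in
  ℚ.nonNegative⁻¹ (p * p) {{ℚ.nonPos*nonPos⇒nonPos p p}}

module _ {A : Set} where

  Σ-const-0 : (xs : List A) → Σ xs (λ _ → 0ℚ) ≡ 0ℚ
  Σ-const-0 []       = refl
  Σ-const-0 (_ ∷ xs) = cong (0ℚ +_) (Σ-const-0 xs)

  Σ-+ : (xs : List A) (g h : A → ℚ) → Σ xs (λ a → g a + h a) ≡ Σ xs g + Σ xs h
  Σ-+ []       g h = refl
  Σ-+ (x ∷ xs) g h = trans (cong (g x + h x +_) (Σ-+ xs g h))
    (solve 4 (λ a b c d → (a :+ b) :+ (c :+ d) := (a :+ c) :+ (b :+ d)) refl (g x) (h x) (Σ xs g) (Σ xs h))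

  Σ-minus : (xs : List A) (g h : A → ℚ) → Σ xs (λ a → g a - h a) ≡ Σ xs g - Σ xs h
  Σ-minus []       g h = refl
  Σ-minus (x ∷ xs) g h = trans (cong (g x - h x +_) (Σ-minus xs g h))
    (solve 4 (λ a b c d → (a :- b) :+ (c :- d) := (a :+ c) :- (b :+ d)) refl (g x) (h x) (Σ xs g) (Σ xs h))

  Σ-*ˡ : (xs : List A) (k : ℚ) (g : A → ℚ) → Σ xs (λ a → k * g a) ≡ k * Σ xs g
  Σ-*ˡ []       k g = sym (ℚ.*-zeroʳ k)
  Σ-*ˡ (x ∷ xs) k g = trans (cong (k * g x +_) (Σ-*ˡ xs k g)) (sym (ℚ.*-distribˡ-+ k (g x) (Σ xs g)))

  Σ-cong : (xs : List A) {g h : A → ℚ} → (∀ {a} → a ∈ xs → g a ≡ h a) → Σ xs g ≡ Σ xs h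
  Σ-cong []       g≡h = refl
  Σ-cong (x ∷ xs) g≡h = cong₂ _+_ (g≡h (here refl)) (Σ-cong xs (g≡h ∘ there))

  Σ-*ʳ : (xs : List A) (k : ℚ) (g : A → ℚ) → Σ xs (λ a → g a * k) ≡ Σ xs g * k
  Σ-*ʳ xs k g = trans (Σ-cong xs (λ {a} _ → ℚ.*-comm (g a) k))
    (trans (Σ-*ˡ xs k g) (ℚ.*-comm k (Σ xs g)))

  Σ-mono-≤ : (xs : List A) {g h : A → ℚ} → (∀ {a} → a ∈ xs → g a ≤ h a) → Σ xs g ≤ Σ xs h
  Σ-mono-≤ []       g≤h = ℚ.≤-refl
  Σ-mono-≤ (x ∷ xs) g≤h = ℚ.+-mono-≤ (g≤h (here refl)) (Σ-mono-≤ xs (g≤h ∘ there))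

  Σ-nonneg : (xs : List A) {g : A → ℚ} → (∀ {a} → a ∈ xs → 0ℚ ≤ g a) → 0ℚ ≤ Σ xs g
  Σ-nonneg xs {g} 0≤g = subst (_≤ Σ xs g) (Σ-const-0 xs) (Σ-mono-≤ xs 0≤g)

  term≤Σ : (xs : List A) {g : A → ℚ} → (∀ {a} → a ∈ xs → 0ℚ ≤ g a) →
           ∀ {a} → a ∈ xs → g a ≤ Σ xs g
  term≤Σ (x ∷ xs) {g} 0≤g (here refl) =
    subst (_≤ g x + Σ xs g) (ℚ.+-identityʳ _) (ℚ.+-monoʳ-≤ (g x) (Σ-nonneg xs (0≤g ∘ there)))
  term≤Σ (x ∷ xs) {g} 0≤g (there a∈xs) = ℚ.≤-trans (term≤Σ xs (0≤g ∘ there) a∈xs)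
    (subst (_≤ g x + Σ xs g) (ℚ.+-identityˡ _) (ℚ.+-monoˡ-≤ (Σ xs g) (0≤g (here refl))))

  Σ-↭ : {xs ys : List A} (g : A → ℚ) → xs ↭ ys → Σ xs g ≡ Σ ys g
  Σ-↭ g xs↭ys = foldr-commMonoid (≡.setoid ℚ) ℚ.+-0-isCommutativeMonoid (↭⇒↭ₛ (↭.map⁺ g xs↭ys))

module _ {A B : Set} where

  Σ-map : (xs : List A) (φ : A → B) (g : B → ℚ) → Σ (map φ xs) g ≡ Σ xs (g ∘ φ)
  Σ-map xs φ g = cong sumℚ (sym (map-∘ xs))

  Σ-comm : (xs : List A) (ys : List B) (g : A → B → ℚ) →
           Σ xs (λ a → Σ ys (g a)) ≡ Σ ys (λ b → Σ xs (λ a → g a b))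
  Σ-comm []       ys g = sym (Σ-const-0 ys)
  Σ-comm (x ∷ xs) ys g = trans (cong (Σ ys (g x) +_) (Σ-comm xs ys g)) (sym (Σ-+ ys (g x) _))

module _ {A : Set} (xs : List A) where

  ΣΣ-+ : (g h : A → A → ℚ) → ΣΣ xs (λ a b → g a b + h a b) ≡ ΣΣ xs g + ΣΣ xs h
  ΣΣ-+ g h = trans (Σ-cong xs (λ {a} _ → Σ-+ xs (g a) (h a))) (Σ-+ xs _ _)

  ΣΣ-minus : (g h : A → A → ℚ) → ΣΣ xs (λ a b → g a b - h a b) ≡ ΣΣ xs g - ΣΣ xs h
  ΣΣ-minus g h = trans (Σ-cong xs (λ {a} _ → Σ-minus xs (g a) (h a))) (Σ-minus xs _ _)

  ΣΣ-*ˡ : (k : ℚ) (g : A → A → ℚ) → ΣΣ xs (λ a b → k * g a b) ≡ k * ΣΣ xs g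
  ΣΣ-*ˡ k g = trans (Σ-cong xs (λ {a} _ → Σ-*ˡ xs k (g a))) (Σ-*ˡ xs k _)

-- p, A t and B t u stand for f x, f (t x) and f (u t x), the values of a function f on the
-- ball of radius two around a vertex x of a Cayley graph with generators Ts.
module LocalΓ₂ {X : Set} (Ts : List X) (p : ℚ) (A : X → ℚ) (B : X → X → ℚ) where

  Γ₀ : ℚ
  Γ₀ = ½ * Σ Ts (λ t → sq (p - A t))

  Γ₁ : X → ℚ
  Γ₁ t = ½ * Σ Ts (λ u → sq (A t - B t u))

  Δ₀ : ℚ
  Δ₀ = Σ Ts (λ u → A u - p)

  Δ₁ : X → ℚ
  Δ₁ t = Σ Ts (λ u → B t u - A t)

  Γ₂-local : ℚ
  Γ₂-local = ½ * Σ Ts (λ t → Γ₁ t - Γ₀) - ½ * Σ Ts (λ t → (p - A t) * (Δ₀ - Δ₁ t))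

  hess : X → X → ℚ
  hess t u = B t u - A t - A u + p

  γ₂ : X → X → ℚ
  γ₂ t u = ½ * (½ * sq (A t - B t u) - ½ * sq (p - A u)) - ½ * ((p - A t) * ((A u - p) - (B t u - A t)))

  Γ₂-local≡ΣΣγ₂ : Γ₂-local ≡ ΣΣ Ts γ₂
  Γ₂-local≡ΣΣγ₂ = begin
    ½ * Σ Ts (λ t → Γ₁ t - Γ₀) - ½ * Σ Ts (λ t → (p - A t) * (Δ₀ - Δ₁ t))
      ≡⟨ cong₂ (λ a b → ½ * a - ½ * b)
           (Σ-cong Ts (λ {t} _ → sym (trans (Σ-minus Ts _ _) (cong₂ _-_ (Σ-*ˡ Ts ½ _) (Σ-*ˡ Ts ½ _)))))
           (Σ-cong Ts (λ {t} _ → sym (trans (Σ-*ˡ Ts (p - A t) _) (cong ((p - A t) *_) (Σ-minus Ts _ _))))) ⟩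
    ½ * ΣΣ Ts (λ t u → ½ * sq (A t - B t u) - ½ * sq (p - A u))
      - ½ * ΣΣ Ts (λ t u → (p - A t) * ((A u - p) - (B t u - A t)))
      ≡⟨ cong₂ _-_ (sym (ΣΣ-*ˡ Ts ½ _)) (sym (ΣΣ-*ˡ Ts ½ _)) ⟩
    ΣΣ Ts (λ t u → ½ * (½ * sq (A t - B t u) - ½ * sq (p - A u)))
      - ΣΣ Ts (λ t u → ½ * ((p - A t) * ((A u - p) - (B t u - A t))))
      ≡⟨ sym (ΣΣ-minus Ts _ _) ⟩
    ΣΣ Ts γ₂ ∎
    where open ≡-Reasoning

  γ₂-as-hess² : ∀ t u → γ₂ t u
      ≡ (sq (½ * hess t u) + (½ * sq (p - A t) - ½ * sq (p - A u)))
        + ½ * ((B t u - p) * (A u - p) - (B t u - p) * (A t - p))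
  γ₂-as-hess² t u = solve 4 (λ P At Au Btu →
      con ½ :* (con ½ :* ((At :- Btu) :* (At :- Btu)) :- con ½ :* ((P :- Au) :* (P :- Au)))
        :- con ½ :* ((P :- At) :* ((Au :- P) :- (Btu :- At)))
      := ((con ½ :* (Btu :- At :- Au :+ P)) :* (con ½ :* (Btu :- At :- Au :+ P))
          :+ (con ½ :* ((P :- At) :* (P :- At)) :- con ½ :* ((P :- Au) :* (P :- Au))))
         :+ con ½ :* ((Btu :- P) :* (Au :- P) :- (Btu :- P) :* (At :- P)))
    refl p (A t) (A u) (B t u)

  module _ (swap : ΣΣ Ts (λ t u → (B t u - p) * (A u - p)) ≡ ΣΣ Ts (λ t u → (B t u - p) * (A t - p))) where

    Γ₂-local≡ΣΣhess² : Γ₂-local ≡ ΣΣ Ts (λ t u → sq (½ * hess t u))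
    Γ₂-local≡ΣΣhess² = begin
      Γ₂-local
        ≡⟨ Γ₂-local≡ΣΣγ₂ ⟩
      ΣΣ Ts γ₂
        ≡⟨ Σ-cong Ts (λ {t} _ → Σ-cong Ts (λ {u} _ → γ₂-as-hess² t u)) ⟩
      ΣΣ Ts (λ t u → (H t u + (S t u - S u t)) + ½ * (K₂ t u - K₁ t u))
        ≡⟨ trans (ΣΣ-+ Ts _ _) (cong₂ _+_ (ΣΣ-+ Ts _ _) (ΣΣ-*ˡ Ts ½ _)) ⟩
      (ΣΣ Ts H + ΣΣ Ts (λ t u → S t u - S u t)) + ½ * ΣΣ Ts (λ t u → K₂ t u - K₁ t u)
        ≡⟨ cong₂ (λ a b → (ΣΣ Ts H + a) + ½ * b) (ΣΣ-minus Ts _ _) (ΣΣ-minus Ts _ _) ⟩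
      (ΣΣ Ts H + (ΣΣ Ts S - ΣΣ Ts (λ t u → S u t))) + ½ * (ΣΣ Ts K₂ - ΣΣ Ts K₁)
        ≡⟨ cong₂ (λ a b → (ΣΣ Ts H + (ΣΣ Ts S - a)) + ½ * (b - ΣΣ Ts K₁))
             (sym (Σ-comm Ts Ts S)) swap ⟩
      (ΣΣ Ts H + (ΣΣ Ts S - ΣΣ Ts S)) + ½ * (ΣΣ Ts K₁ - ΣΣ Ts K₁)
        ≡⟨ solve 3 (λ h s k → (h :+ (s :- s)) :+ con ½ :* (k :- k) := h) refl
             (ΣΣ Ts H) (ΣΣ Ts S) (ΣΣ Ts K₁) ⟩
      ΣΣ Ts H ∎
      where
        open ≡-Reasoning
        H S K₁ K₂ : X → X → ℚ
        H t u = sq (½ * hess t u)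
        S t u = ½ * sq (p - A t)
        K₁ t u = (B t u - p) * (A t - p)
        K₂ t u = (B t u - p) * (A u - p)

    2Γ₀≤Γ₂-local : (∀ {t} → t ∈ Ts → B t t ≡ p) → 2ℚ * Γ₀ ≤ Γ₂-local
    2Γ₀≤Γ₂-local Btt≡p = begin
      2ℚ * Γ₀                           ≡⟨ solve 1 (λ s → con 2ℚ :* (con ½ :* s) := s) refl _ ⟩
      Σ Ts (λ t → sq (p - A t))         ≡⟨ Σ-cong Ts sq≡hess² ⟩
      Σ Ts (λ t → sq (½ * hess t t))    ≤⟨ Σ-mono-≤ Ts (λ {t} → term≤Σ Ts (λ {u} _ → sq-nonneg (½ * hess t u))) ⟩
      ΣΣ Ts (λ t u → sq (½ * hess t u)) ≡⟨ sym Γ₂-local≡ΣΣhess² ⟩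
      Γ₂-local                          ∎
      where
        open ℚ.≤-Reasoning
        sq≡hess² : ∀ {t} → t ∈ Ts → sq (p - A t) ≡ sq (½ * hess t t)
        sq≡hess² {t} t∈Ts rewrite Btt≡p t∈Ts = solve 2 (λ P At →
          (P :- At) :* (P :- At) := (con ½ :* (P :- At :- At :+ P)) :* (con ½ :* (P :- At :- At :+ P)))
          refl p (A t)

module Conjugation {c ℓ} (G : Group c ℓ) where

  open Group G
  open import Algebra.Properties.Group G
  open import Relation.Binary.Reasoning.Setoid setoid

  conj : Carrier → Carrier → Carrier
  conj g x = g ∙ x ∙ g ⁻¹

  ∙-conj : ∀ g x y → g ∙ (x ∙ y) ≈ conj g x ∙ (g ∙ y)
  ∙-conj g x y = begin
    g ∙ (x ∙ y)               ≈⟨ assoc g x y ⟨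
    g ∙ x ∙ y                 ≈⟨ ∙-congˡ (\\-leftDividesʳ g y) ⟨
    g ∙ x ∙ (g ⁻¹ ∙ (g ∙ y))  ≈⟨ assoc (g ∙ x) (g ⁻¹) (g ∙ y) ⟨
    conj g x ∙ (g ∙ y)        ∎

  conj-∙ : ∀ g x y → conj g (x ∙ y) ≈ conj g x ∙ conj g y
  conj-∙ g x y = begin
    g ∙ (x ∙ y) ∙ g ⁻¹          ≈⟨ ∙-congʳ (∙-conj g x y) ⟩
    conj g x ∙ (g ∙ y) ∙ g ⁻¹   ≈⟨ assoc (conj g x) (g ∙ y) (g ⁻¹) ⟩
    conj g x ∙ conj g y         ∎

  conj-ε : ∀ g → conj g ε ≈ ε
  conj-ε g = begin
    g ∙ ε ∙ g ⁻¹  ≈⟨ ∙-congʳ (identityʳ g) ⟩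
    g ∙ g ⁻¹      ≈⟨ inverseʳ g ⟩
    ε             ∎

  conj-conj : ∀ g h x → conj g (conj h x) ≈ conj (g ∙ h) x
  conj-conj g h x = begin
    g ∙ (h ∙ x ∙ h ⁻¹) ∙ g ⁻¹        ≈⟨ ∙-congʳ (assoc g (h ∙ x) (h ⁻¹)) ⟨
    g ∙ (h ∙ x) ∙ h ⁻¹ ∙ g ⁻¹        ≈⟨ assoc (g ∙ (h ∙ x)) (h ⁻¹) (g ⁻¹) ⟩
    g ∙ (h ∙ x) ∙ (h ⁻¹ ∙ g ⁻¹)      ≈⟨ ∙-cong (assoc g h x) (⁻¹-anti-homo-∙ g h) ⟨
    g ∙ h ∙ x ∙ (g ∙ h) ⁻¹           ∎

  conj-inverse : ∀ g x → conj g (conj (g ⁻¹) x) ≈ x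
  conj-inverse g x = begin
    conj g (conj (g ⁻¹) x)        ≈⟨ conj-conj g (g ⁻¹) x ⟩
    g ∙ g ⁻¹ ∙ x ∙ (g ∙ g ⁻¹) ⁻¹  ≈⟨ ∙-cong (∙-congʳ (inverseʳ g)) (⁻¹-cong (inverseʳ g)) ⟩
    ε ∙ x ∙ ε ⁻¹                  ≈⟨ ∙-cong (identityˡ x) ε⁻¹≈ε ⟩
    x ∙ ε                         ≈⟨ identityʳ x ⟩
    x                             ∎

  conj-injective : ∀ g {x y} → conj g x ≈ conj g y → x ≈ y
  conj-injective g {x} {y} eq = ∙-cancelˡ g x y (∙-cancelʳ (g ⁻¹) (g ∙ x) (g ∙ y) eq)

↭-unique-set : {A : Set} {xs ys : List A} → Unique xs → Unique ys →
  (∀ {z} → z ∈ xs ⇔ z ∈ ys) → xs ↭ ys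
↭-unique-set xs! ys! xs≈ys = ∼bag⇒↭ (unique∧set⇒bag xs! ys! xs≈ys)

module CayleyGraph {G : Set} {_∙_ : G → G → G} {ε : G} {_⁻¹ : G → G}
  (isGroup : IsGroup _≡_ _∙_ ε _⁻¹)
  (Ts : List G) (Ts-unique : Unique Ts)
  (involution : ∀ {t} → t ∈ Ts → t ∙ t ≡ ε)
  (conj-closed : ∀ g {t} → t ∈ Ts → (g ∙ t) ∙ (g ⁻¹) ∈ Ts)
  (N : G → List G) (N-unique : ∀ y → Unique (N y))
  (∈N⇔ : ∀ {y v} → v ∈ N y ⇔ v ∙ (y ⁻¹) ∈ Ts)
  where

  group : Group 0ℓ 0ℓ
  group = record { Carrier = G ; _≈_ = _≡_ ; _∙_ = _∙_ ; ε = ε ; _⁻¹ = _⁻¹ ; isGroup = isGroup }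

  open IsGroup isGroup using (assoc; identityˡ)
  open import Algebra.Properties.Group group using (∙-cancelʳ; //-rightDividesˡ; //-rightDividesʳ)
  open Conjugation group
  open Operators N

  N↭Ts∙ : ∀ y → N y ↭ map (_∙ y) Ts
  N↭Ts∙ y = ↭-unique-set (N-unique y) (Unique.map⁺ (∙-cancelʳ y _ _) Ts-unique) (mk⇔ to from)
    where
      to : ∀ {v} → v ∈ N y → v ∈ map (_∙ y) Ts
      to {v} v∈Ny = subst (_∈ map (_∙ y) Ts) (//-rightDividesˡ y v)
        (∈-map⁺ (_∙ y) (Equivalence.to ∈N⇔ v∈Ny))
      from : ∀ {v} → v ∈ map (_∙ y) Ts → v ∈ N y
      from v∈Ts∙y with ∈-map⁻ (_∙ y) v∈Ts∙y
      ... | t , t∈Ts , refl = Equivalence.from ∈N⇔ (subst (_∈ Ts) (sym (//-rightDividesʳ y t)) t∈Ts)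

  conj-invariant : ∀ g → map (conj g) Ts ↭ Ts
  conj-invariant g = ↭-unique-set (Unique.map⁺ (conj-injective g) Ts-unique) Ts-unique (mk⇔ to from)
    where
      to : ∀ {t} → t ∈ map (conj g) Ts → t ∈ Ts
      to t∈gTsg⁻¹ with ∈-map⁻ (conj g) t∈gTsg⁻¹
      ... | t , t∈Ts , refl = conj-closed g t∈Ts
      from : ∀ {t} → t ∈ Ts → t ∈ map (conj g) Ts
      from {t} t∈Ts = subst (_∈ map (conj g) Ts) (conj-inverse g t)
        (∈-map⁺ (conj g) (conj-closed (g ⁻¹) t∈Ts))

  Σ-N : ∀ y (h : G → ℚ) → Σ (N y) h ≡ Σ Ts (λ t → h (t ∙ y))
  Σ-N y h = trans (Σ-↭ h (N↭Ts∙ y)) (Σ-map Ts (_∙ y) h)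

  Σ-translate : ∀ g y (h : G → ℚ) → Σ Ts (λ t → h (g ∙ (t ∙ y))) ≡ Σ Ts (λ t → h (t ∙ (g ∙ y)))
  Σ-translate g y h = begin
    Σ Ts (λ t → h (g ∙ (t ∙ y)))            ≡⟨ Σ-cong Ts (λ {t} _ → cong h (∙-conj g t y)) ⟩
    Σ Ts (λ t → h (conj g t ∙ (g ∙ y)))     ≡⟨ Σ-map Ts (conj g) _ ⟨
    Σ (map (conj g) Ts) (λ t → h (t ∙ (g ∙ y)))  ≡⟨ Σ-↭ _ (conj-invariant g) ⟩
    Σ Ts (λ t → h (t ∙ (g ∙ y)))            ∎
    where open ≡-Reasoning

  involution-cancel : ∀ {t} → t ∈ Ts → ∀ x → t ∙ (t ∙ x) ≡ x
  involution-cancel {t} t∈Ts x = trans (sym (assoc t t x)) (trans (cong (_∙ x) (involution t∈Ts)) (identityˡ x))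

  ΣΣ-swap-steps : ∀ (h k : G → ℚ) x →
    ΣΣ Ts (λ t u → h (u ∙ (t ∙ x)) * k (u ∙ x)) ≡ ΣΣ Ts (λ t u → h (u ∙ (t ∙ x)) * k (t ∙ x))
  ΣΣ-swap-steps h k x = begin
    ΣΣ Ts (λ t u → h (u ∙ (t ∙ x)) * k (u ∙ x))          ≡⟨ Σ-comm Ts Ts _ ⟩
    Σ Ts (λ u → Σ Ts (λ t → h (u ∙ (t ∙ x)) * k (u ∙ x))) ≡⟨ Σ-cong Ts (λ _ → Σ-*ʳ Ts _ _) ⟩
    Σ Ts (λ u → Σ Ts (λ t → h (u ∙ (t ∙ x))) * k (u ∙ x))
      ≡⟨ Σ-cong Ts (λ {u} _ → cong (_* k (u ∙ x)) (Σ-translate u x h)) ⟩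
    Σ Ts (λ u → Σ Ts (λ t → h (t ∙ (u ∙ x))) * k (u ∙ x)) ≡⟨ Σ-cong Ts (λ _ → Σ-*ʳ Ts _ _) ⟨
    ΣΣ Ts (λ u t → h (t ∙ (u ∙ x)) * k (u ∙ x))          ∎
    where open ≡-Reasoning

  2Γ≤Γ₂ : ∀ f x → 2ℚ * Γ f f x ≤ Γ₂ f x
  2Γ≤Γ₂ f x = subst₂ _≤_ (cong (2ℚ *_) (sym (Γ-local x))) (sym Γ₂≡Γ₂-local)
    (2Γ₀≤Γ₂-local (ΣΣ-swap-steps (λ v → f v - p) (λ v → f v - p) x)
                  (λ t∈Ts → cong f (involution-cancel t∈Ts x)))
    where
      p : ℚ
      p = f x
      open LocalΓ₂ Ts p (λ t → f (t ∙ x)) (λ t u → f (u ∙ (t ∙ x)))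

      Γ-local : ∀ y → Γ f f y ≡ ½ * Σ Ts (λ u → sq (f y - f (u ∙ y)))
      Γ-local y = cong (½ *_) (Σ-N y _)

      Γ₂≡Γ₂-local : Γ₂ f x ≡ Γ₂-local
      Γ₂≡Γ₂-local = cong₂ (λ a b → ½ * a - ½ * b)
        (trans (Σ-N x _) (Σ-cong Ts (λ {t} _ → cong₂ _-_ (Γ-local (t ∙ x)) (Γ-local x))))
        (trans (Σ-N x _) (Σ-cong Ts (λ {t} _ →
          cong ((p - f (t ∙ x)) *_) (cong₂ _-_ (Σ-N x _) (Σ-N (t ∙ x) _)))))

module RegularBipartiteGraph {V : Set} (N : V → List V) (N-unique : ∀ y → Unique (N y))
  (colour : V → Bool) (bipartite : ∀ {x v} → v ∈ N x → colour v ≡ not (colour x))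
  (o : V) (_≟o : ∀ y → Dec (y ≡ o))
  (regular : ∀ {v} → v ∈ N o → Σ (N v) (λ _ → 1ℚ) ≡ Σ (N o) (λ _ → 1ℚ))
  (o-not-isolated : ∃ (_∈ N o))
  where

  open Operators N

  -- On the ball of radius two around o, F is the graph distance to o.
  F : V → ℚ
  F y with y ≟o | colour y Bool.≟ colour o
  ... | yes _ | _     = 0ℚ
  ... | no _  | no _  = 1ℚ
  ... | no _  | yes _ = 2ℚ

  𝟙o : V → ℚ
  𝟙o y with y ≟o
  ... | yes _ = 1ℚ
  ... | no _  = 0ℚ

  𝟙o-≢o : ∀ {z} → z ≢ o → 𝟙o z ≡ 0ℚ
  𝟙o-≢o {z} z≢o with z ≟o
  ... | yes z≡o = ⊥-elim (z≢o z≡o)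
  ... | no _    = refl

  D : ℚ
  D = Σ (N o) (λ _ → 1ℚ)

  F-o : F o ≡ 0ℚ
  F-o with o ≟o
  ... | yes _  = refl
  ... | no o≢o = ⊥-elim (o≢o refl)

  F-nbr : ∀ {v} → v ∈ N o → F v ≡ 1ℚ
  F-nbr {v} v∈No with v ≟o | colour v Bool.≟ colour o
  ... | yes refl | _         = ⊥-elim (not-¬ refl (bipartite v∈No))
  ... | no _     | no _      = refl
  ... | no _     | yes same  = ⊥-elim (not-¬ same (bipartite v∈No))

  F-second-nbr : ∀ {v w} → v ∈ N o → w ∈ N v →
                 (F w ≡ 0ℚ × 𝟙o w ≡ 1ℚ) ⊎ (F w ≡ 2ℚ × 𝟙o w ≡ 0ℚ)
  F-second-nbr {v} {w} v∈No w∈Nv with w ≟o | colour w Bool.≟ colour o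
  ... | yes _ | _         = inj₁ (refl , refl)
  ... | no _  | yes _     = inj₂ (refl , refl)
  ... | no _  | no differ = ⊥-elim (differ (begin
    colour w              ≡⟨ bipartite w∈Nv ⟩
    not (colour v)        ≡⟨ cong not (bipartite v∈No) ⟩
    not (not (colour o))  ≡⟨ not-involutive (colour o) ⟩
    colour o              ∎))
    where open ≡-Reasoning

  Σ𝟙o≤1 : ∀ ys → Unique ys → Σ ys 𝟙o ≤ 1ℚ
  Σ𝟙o≤1 []                  _ = ℚ.nonNegative⁻¹ 1ℚ
  Σ𝟙o≤1 (y ∷ ys) (y∉ys ∷ ys!) with y ≟o
  ... | yes refl = ℚ.≤-reflexive (trans (cong (1ℚ +_) Σys≡0) (ℚ.+-identityʳ 1ℚ))
    where
      Σys≡0 : Σ ys 𝟙o ≡ 0ℚ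
      Σys≡0 = trans (Σ-cong ys (λ z∈ys → 𝟙o-≢o (All.lookup y∉ys z∈ys ∘ sym))) (Σ-const-0 ys)
  ... | no _ = subst (_≤ 1ℚ) (sym (ℚ.+-identityˡ (Σ ys 𝟙o))) (Σ𝟙o≤1 ys ys!)

  Γ-at-o : Γ F F o ≡ ½ * D
  Γ-at-o = cong (½ *_) (Σ-cong (N o) (λ v∈No → cong₂ (λ a b → sq (a - b)) F-o (F-nbr v∈No)))

  Γ-at-nbr : ∀ {v} → v ∈ N o → Γ F F v ≡ ½ * D
  Γ-at-nbr {v} v∈No = cong (½ *_) (trans (Σ-cong (N v) jump-1) (regular v∈No))
    where
      jump-1 : ∀ {w} → w ∈ N v → sq (F v - F w) ≡ 1ℚ
      jump-1 w∈Nv rewrite F-nbr v∈No with F-second-nbr v∈No w∈Nv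
      ... | inj₁ (Fw≡0 , _) rewrite Fw≡0 = refl
      ... | inj₂ (Fw≡2 , _) rewrite Fw≡2 = refl

  Δ-at-o : Δ F o ≡ D
  Δ-at-o = Σ-cong (N o) (λ v∈No → cong₂ _-_ (F-nbr v∈No) F-o)

  Δ-at-nbr : ∀ {v} → v ∈ N o → Δ F v ≡ D - 2ℚ * Σ (N v) 𝟙o
  Δ-at-nbr {v} v∈No = begin
    Σ (N v) (λ w → F w - F v)                             ≡⟨ Σ-cong (N v) step ⟩
    Σ (N v) (λ w → 1ℚ - 2ℚ * 𝟙o w)                        ≡⟨ Σ-minus (N v) _ _ ⟩
    Σ (N v) (λ _ → 1ℚ) - Σ (N v) (λ w → 2ℚ * 𝟙o w)        ≡⟨ cong₂ _-_ (regular v∈No) (Σ-*ˡ (N v) 2ℚ 𝟙o) ⟩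
    D - 2ℚ * Σ (N v) 𝟙o                                   ∎
    where
      open ≡-Reasoning
      step : ∀ {w} → w ∈ N v → F w - F v ≡ 1ℚ - 2ℚ * 𝟙o w
      step w∈Nv rewrite F-nbr v∈No with F-second-nbr v∈No w∈Nv
      ... | inj₁ (Fw≡0 , 𝟙ow≡1) rewrite Fw≡0 | 𝟙ow≡1 = refl
      ... | inj₂ (Fw≡2 , 𝟙ow≡0) rewrite Fw≡2 | 𝟙ow≡0 = refl

  Γ₂-at-o : Γ₂ F o ≡ Σ (N o) (λ v → Σ (N v) 𝟙o)
  Γ₂-at-o = begin
    ½ * Σ (N o) (λ v → Γ F F v - Γ F F o) - ½ * Σ (N o) (λ v → (F o - F v) * (Δ F o - Δ F v))
      ≡⟨ cong₂ (λ a b → ½ * a - ½ * b) (Σ-cong (N o) flat) (Σ-cong (N o) slope) ⟩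
    ½ * Σ (N o) (λ _ → 0ℚ) - ½ * Σ (N o) (λ v → - 2ℚ * Σ (N v) 𝟙o)
      ≡⟨ cong₂ (λ a b → ½ * a - ½ * b) (Σ-const-0 (N o)) (Σ-*ˡ (N o) (- 2ℚ) _) ⟩
    ½ * 0ℚ - ½ * (- 2ℚ * Σ (N o) (λ v → Σ (N v) 𝟙o))
      ≡⟨ solve 1 (λ s → con ½ :* con 0ℚ :- con ½ :* (con (- 2ℚ) :* s) := s) refl _ ⟩
    Σ (N o) (λ v → Σ (N v) 𝟙o) ∎
    where
      open ≡-Reasoning
      flat : ∀ {v} → v ∈ N o → Γ F F v - Γ F F o ≡ 0ℚ
      flat v∈No = trans (cong₂ _-_ (Γ-at-nbr v∈No) Γ-at-o) (ℚ.+-inverseʳ (½ * D))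
      slope : ∀ {v} → v ∈ N o → (F o - F v) * (Δ F o - Δ F v) ≡ - 2ℚ * Σ (N v) 𝟙o
      slope {v} v∈No = trans (cong₂ (λ a b → (a - F v) * b) F-o (cong₂ _-_ Δ-at-o (Δ-at-nbr v∈No)))
        (trans (cong (λ a → (0ℚ - a) * (D - (D - 2ℚ * Σ (N v) 𝟙o))) (F-nbr v∈No))
          (solve 2 (λ d i → (con 0ℚ :- con 1ℚ) :* (d :- (d :- con 2ℚ :* i)) := con (- 2ℚ) :* i)
            refl D (Σ (N v) 𝟙o)))

  Γ₂≤2Γ-at-o : Γ₂ F o ≤ 2ℚ * Γ F F o
  Γ₂≤2Γ-at-o = begin
    Γ₂ F o                          ≡⟨ Γ₂-at-o ⟩
    Σ (N o) (λ v → Σ (N v) 𝟙o)      ≤⟨ Σ-mono-≤ (N o) (λ {v} _ → Σ𝟙o≤1 (N v) (N-unique v)) ⟩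
    D                               ≡⟨ solve 1 (λ d → d := con 2ℚ :* (con ½ :* d)) refl D ⟩
    2ℚ * (½ * D)                    ≡⟨ cong (2ℚ *_) Γ-at-o ⟨
    2ℚ * Γ F F o                    ∎
    where open ℚ.≤-Reasoning

  0<Γ-at-o : 0ℚ < Γ F F o
  0<Γ-at-o = begin-strict
    0ℚ           <⟨ ℚ.positive⁻¹ ½ ⟩
    ½ * 1ℚ       ≤⟨ ℚ.*-monoˡ-≤-nonNeg ½ 1≤D ⟩
    ½ * D        ≡⟨ Γ-at-o ⟨
    Γ F F o      ∎
    where
      open ℚ.≤-Reasoning
      1≤D : 1ℚ ≤ D
      1≤D = term≤Σ (N o) (λ _ → ℚ.nonNegative⁻¹ 1ℚ) (proj₂ o-not-isolated)

module _ {V : Set} (N : V → List V) where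

  open Operators N

  RicEq-attained : ∀ K → (∀ f x → K * Γ f f x ≤ Γ₂ f x) →
    ∀ f x → Γ₂ f x ≤ K * Γ f f x → 0ℚ < Γ f f x → RicEq K
  RicEq-attained K lower f x sharp 0<Γ = lower , λ K′ K<K′ → f , x ,
    ℚ.≤-<-trans sharp (ℚ.*-monoˡ-<-pos (Γ f f x) {{Data.Rational.positive 0<Γ}} K<K′)

coxeterGroup : CoxeterSystem → Group 0ℓ 0ℓ
coxeterGroup C = record
  { Carrier = W ; _≈_ = _≡_ ; _∙_ = _·_ ; ε = e ; _⁻¹ = inv
  ; isGroup = record
    { isMonoid = record
      { isSemigroup = record
        { isMagma = record { isEquivalence = ≡.isEquivalence ; ∙-cong = cong₂ _·_ }
        ; assoc = assoc }
      ; identity = identityˡ , identityʳ }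
    ; inverse = inverseˡ , inverseʳ
    ; ⁻¹-cong = cong inv } }
  where open CoxeterSystem C

xorGroup : Group 0ℓ 0ℓ
xorGroup = AbelianGroup.group (CommutativeRing.+-abelianGroup xor-∧-commutativeRing)

parity : ℕ → Bool
parity zero    = false
parity (suc k) = not (parity k)

module SignCharacter (C : CoxeterSystem) where

  open CoxeterSystem C
  open Conjugation (coxeterGroup C)

  gpow-false : ∀ k → gpow xorGroup false k ≡ false
  gpow-false zero    = refl
  gpow-false (suc k) = gpow-false k

  -- Send every generator to true; the relations hold since (true xor true)^m = false.
  sign-homomorphism : ∃ λ (φ : W → Bool) →
    (∀ x y → φ (x · y) ≡ φ x xor φ y) × (∀ i → φ (s i) ≡ true)
  sign-homomorphism = universal xorGroup (λ _ → true) (λ i j → gpow-false (m i j))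

  sign : W → Bool
  sign = proj₁ sign-homomorphism

  sign-· : ∀ x y → sign (x · y) ≡ sign x xor sign y
  sign-· = proj₁ (proj₂ sign-homomorphism)

  sign-s : ∀ i → sign (s i) ≡ true
  sign-s = proj₂ (proj₂ sign-homomorphism)

  sign-e : sign e ≡ false
  sign-e = begin
    sign e                 ≡⟨ cong sign (identityˡ e) ⟨
    sign (e · e)           ≡⟨ sign-· e e ⟩
    sign e xor sign e      ≡⟨ xor-same (sign e) ⟩
    false                  ∎
    where open ≡-Reasoning

  sign-inv : ∀ g → sign (inv g) ≡ sign g
  sign-inv g = sym (x∙y⁻¹≈ε⇒x≈y (sign g) (sign (inv g))
    (trans (sym (sign-· g (inv g))) (trans (cong sign (inverseʳ g)) sign-e)))
    where open import Algebra.Properties.Group xorGroup using (x∙y⁻¹≈ε⇒x≈y) -- here y ⁻¹ = y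

  sign-conj : ∀ g x → sign (conj g x) ≡ sign x
  sign-conj g x = begin
    sign ((g · x) · inv g)                ≡⟨ sign-· (g · x) (inv g) ⟩
    sign (g · x) xor sign (inv g)         ≡⟨ cong₂ _xor_ (sign-· g x) (sign-inv g) ⟩
    (sign g xor sign x) xor sign g        ≡⟨ xor-cancel (sign g) (sign x) ⟩
    sign x                                ∎
    where
      open ≡-Reasoning
      xor-cancel : ∀ a b → (a xor b) xor a ≡ b
      xor-cancel false b     = xor-identityʳ b
      xor-cancel true  false = refl
      xor-cancel true  true  = refl

  sign-prod : ∀ word → sign (prod C word) ≡ parity (length word)
  sign-prod []         = sign-e
  sign-prod (i ∷ word) = trans (sign-· (s i) (prod C word)) (cong₂ _xor_ (sign-s i) (sign-prod word))

  sign-length : ∀ {w k} → IsLength C w k → sign w ≡ parity k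
  sign-length ((word , refl , refl) , _) = sign-prod word

  sign-reflection : ∀ {t} → IsReflection C t → sign t ≡ true
  sign-reflection (w , i , refl) = trans (sign-conj w (s i)) (sign-s i)

module BruhatGraph (C : CoxeterSystem) (no-isolated : NoIsolated C)
  (N : CoxeterSystem.W C → List (CoxeterSystem.W C)) (isN : IsNeighbourhood C N) where

  open CoxeterSystem C
  open import Algebra.Properties.Group (coxeterGroup C) using (ε⁻¹≈ε; //-rightDividesˡ; //-rightDividesʳ)
  open Conjugation (coxeterGroup C)
  open SignCharacter C

  ∈N⇒Adj : ∀ {x v} → v ∈ N x → Adj C x v
  ∈N⇒Adj {x} {v} = Equivalence.to (proj₂ (isN x) v)

  Adj⇒∈N : ∀ {x v} → Adj C x v → v ∈ N x
  Adj⇒∈N {x} {v} = Equivalence.from (proj₂ (isN x) v)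

  s-involution : ∀ i → s i · s i ≡ e
  s-involution i = trans (sym (identityʳ (s i · s i)))
    (subst (λ k → powW _·_ e (s i · s i) k ≡ e) (m-diag i) (relations i i))

  reflection-involution : ∀ {t} → IsReflection C t → t · t ≡ e
  reflection-involution (w , i , refl) =
    trans (sym (conj-∙ w (s i) (s i))) (trans (cong (conj w) (s-involution i)) (conj-ε w))

  reflection-cancel : ∀ {t} → IsReflection C t → ∀ x → t · (t · x) ≡ x
  reflection-cancel rt x = trans (sym (assoc _ _ x)) (trans (cong (_· x) (reflection-involution rt)) (identityˡ x))

  reflection-conj : ∀ g {t} → IsReflection C t → IsReflection C (conj g t)
  reflection-conj g (w , i , refl) = g · w , i , conj-conj g w (s i)

  -- Minimising over words would need decidable equality on W; instead every vertex gets
  -- its length from an incident edge.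
  length-exists : ∀ w → ∃ (IsLength C w)
  length-exists w with no-isolated w
  ... | _ , inj₁ (_ , _ , _ , _ , b , _ , ℓw , _) = b , ℓw
  ... | _ , inj₂ (_ , _ , _ , a , _ , ℓw , _ , _) = a , ℓw

  Adj-reflection : ∀ {t} x → IsReflection C t → Adj C x (t · x)
  Adj-reflection {t} x rt with length-exists (t · x) | length-exists x
  ... | a , ℓtx | b , ℓx with ℕ.<-cmp a b
  ... | tri< a<b _ _   = inj₁ (t , rt , refl , a , b , ℓtx , ℓx , a<b)
  ... | tri> _ _ a>b   = inj₂ (t , rt , sym (reflection-cancel rt x) , b , a , ℓx , ℓtx , a>b)
  ... | tri≈ _ refl _  = ⊥-elim (not-¬ (sign-length ℓtx)
        (trans (sign-· t x) (cong₂ _xor_ (sign-reflection rt) (sign-length ℓx))))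

  reflection-Adj : ∀ {x v} → Adj C x v → IsReflection C (v · inv x)
  reflection-Adj {x} (inj₁ (t , rt , refl , _)) = subst (IsReflection C) (sym (//-rightDividesʳ x t)) rt
  reflection-Adj {v = v} (inj₂ (t , rt , refl , _)) = subst (IsReflection C)
    (sym (trans (cong (_· inv (t · v)) (sym (reflection-cancel rt v))) (//-rightDividesʳ (t · v) t))) rt

  Adj⇔reflection : ∀ {x v} → Adj C x v ⇔ IsReflection C (v · inv x)
  Adj⇔reflection {x} {v} = mk⇔ reflection-Adj
    (λ r → subst (Adj C x) (//-rightDividesˡ x v) (Adj-reflection x r))

  reflection⇔∈N-e : ∀ {t} → IsReflection C t ⇔ t ∈ N e
  reflection⇔∈N-e {t} = mk⇔
    (λ rt → Adj⇒∈N (subst (Adj C e) (identityʳ t) (Adj-reflection e rt)))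
    (λ t∈Ne → subst (IsReflection C) t·e⁻¹≡t (reflection-Adj (∈N⇒Adj t∈Ne)))
    where
      t·e⁻¹≡t : t · inv e ≡ t
      t·e⁻¹≡t = trans (cong (t ·_) ε⁻¹≈ε) (identityʳ t)

  ∈N⇔ : ∀ {y v} → v ∈ N y ⇔ v · inv y ∈ N e
  ∈N⇔ = mk⇔
    (Equivalence.to reflection⇔∈N-e ∘ reflection-Adj ∘ ∈N⇒Adj)
    (Adj⇒∈N ∘ Equivalence.from Adj⇔reflection ∘ Equivalence.from reflection⇔∈N-e)

  N-e-involution : ∀ {t} → t ∈ N e → t · t ≡ e
  N-e-involution = reflection-involution ∘ Equivalence.from reflection⇔∈N-e

  N-e-conj-closed : ∀ g {t} → t ∈ N e → conj g t ∈ N e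
  N-e-conj-closed g = Equivalence.to reflection⇔∈N-e ∘ reflection-conj g ∘ Equivalence.from reflection⇔∈N-e

  sign-bipartite : ∀ {x v} → v ∈ N x → sign v ≡ not (sign x)
  sign-bipartite {x} {v} v∈Nx = begin
    sign v                       ≡⟨ cong sign (//-rightDividesˡ x v) ⟨
    sign ((v · inv x) · x)       ≡⟨ sign-· (v · inv x) x ⟩
    sign (v · inv x) xor sign x  ≡⟨ cong (_xor sign x) (sign-reflection (reflection-Adj (∈N⇒Adj v∈Nx))) ⟩
    not (sign x)                 ∎
    where open ≡-Reasoning

  _≟e : ∀ y → Dec (y ≡ e)
  y ≟e with length-exists y
  ... | zero  , (([] , _ , refl) , _) = yes refl
  ... | suc k , (_ , minimal)         = no (λ y≡e → n≮0 (minimal [] (sym y≡e)))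

  e-not-isolated : ∃ (_∈ N e)
  e-not-isolated with no-isolated e
  ... | v , e~v = v , Adj⇒∈N e~v

theorem3p1 : (C : CoxeterSystem) → FiniteW C → NoIsolated C →
    (N : CoxeterSystem.W C → List (CoxeterSystem.W C)) → IsNeighbourhood C N →
    Operators.RicEq N 2ℚ
theorem3p1 C _ no-isolated N isN = RicEq-attained N 2ℚ 2Γ≤Γ₂ F e Γ₂≤2Γ-at-o 0<Γ-at-o
  where
    open CoxeterSystem C using (e)
    open SignCharacter C using (sign)
    open BruhatGraph C no-isolated N isN
    open CayleyGraph (Group.isGroup (coxeterGroup C)) (N e) (proj₁ (isN e)) N-e-involution N-e-conj-closed
      N (proj₁ ∘ isN) ∈N⇔ using (2Γ≤Γ₂; Σ-N)
    open RegularBipartiteGraph N (proj₁ ∘ isN) sign sign-bipartite e _≟e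
      (λ {v} _ → Σ-N v (λ _ → 1ℚ)) e-not-isolated using (F; Γ₂≤2Γ-at-o; 0<Γ-at-o)
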